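{- Let $0\le r\le s\le n$ and let $\mu\in\mathbb T^{\binom{[n]}{r}}$ and $\nu\in\mathbb T^{\binom{[n]}{s}}$, neither the all-$\infty$ vector. Then $(\bar\mu,\bar\nu)\in\mathbb P(\mathbb T^{\binom{[n]}{r}})\times\mathbb P(\mathbb T^{\binom{[n]}{s}})$ lies in the flag Dressian $FlDr(r,s;n)$ if and only if $\mu$ and $\nu$ are valuated matroids and $\mu\twoheadleftarrow\nu$. Consequently the points of $FlDr(r_1,\dots,r_k;n)$ correspond to the valuated flag matroids of rank $(r_1,\dots,r_k)$ on $[n]$.
   Context: $\mathbb T=\mathbb R\cup\{\infty\}$; $\mathbb P(\mathbb T^E)$ is $\mathbb T^E$ minus the all-$\infty$ vector, modulo adding real multiples of $\mathbf 1$; $\bar u$ is the class of $u$. "The minimum is attained at least twice" holds by convention when all entries are $\infty$. A valuated matroid of rank $r$ on $[n]$ is $\mu:\binom{[n]}{r}\to\mathbb T$ such that $\mathcal B(M)=\{I:\mu(I)\ne\infty\}$ is the set of bases of a matroid $M$ and for all $B,B'\in\mathcal B(M)$, $i\in B\setminus B'$ there is $j\in B'\setminus B$ with $\mu(B)+\mu(B')\ge\mu(B\setminus i\cup j)+\mu(B'\setminus j\cup i)$. For valuated matroids $\mu,\nu$ of ranks $r\le s$ with underlying matroids $M,N$, $\mu\twoheadleftarrow\nu$ means: for all $I\in\mathcal B(M)$, $J\in\mathcal B(N)$ and $i\in I\setminus J$ there exists $j\in J\setminus I$ with $\mu(I)+\nu(J)\ge\mu(I\setminus i\cup j)+\nu(J\setminus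 j\cup i)$. A valuated flag matroid is a sequence $(\mu_1,\dots,\mu_k)$ with $\mu_i\twoheadleftarrow\mu_j$ for all $i<j$. Tropical Grassmann–Plücker relations for $p\in\mathbb T^{\binom{[n]}{r}}$: for all $I,J\in\binom{[n]}{r}$ with $|I\cap J|<r-1$ and $i\in I\setminus J$, the minimum of $\{p(I)+p(J)\}\cup\{p(I\setminus i\cup j)+p(J\setminus j\cup i):j\in J\setminus I\}$ is attained at least twice. Tropical incidence–Plücker relations for $(p,q)\in\mathbb T^{\binom{[n]}{r}}\times\mathbb T^{\binom{[n]}{s}}$: for all $I'\in\binom{[n]}{r-1}$, $J'\in\binom{[n]}{s+1}$, the minimum of $\{p(I'\cup j)+q(J'\setminus j):j\in J'\setminus I'\}$ is attained at least twice. The flag Dressian $FlDr(r_1,\dots,r_k;n)$, $0\le r_1\le\cdots\le r_k\le n$, is the set of $(\overline{p_1},\dots,\overline{p_k})\in\prod_i\mathbb P(\mathbb T^{\binom{[n]}{r_i}})$ such that each $p_i$ satisfies the Grassmann–Plücker relations and each pair $(p_i,p_j)$ with $i<j$ satisfies the incidence–Plücker relations. -}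

module Defs where

open import Data.Nat using (ℕ; suc; _<_) renaming (_≤_ to _≤ℕ_)
open import Data.Fin using (Fin) renaming (_<_ to _<ᶠ_; _≤_ to _≤ᶠ_)
open import Data.Fin.Subset using (Subset; _∈_; _∉_; _∩_; _∪_; _-_; ⁅_⁆; ∣_∣)
open import Data.Maybe using (Maybe; just; nothing)
open import Data.Vec using (Vec; lookup; _∷_; [])
open import Data.Product using (Σ; ∃; _×_; _,_)
open import Data.Sum using (_⊎_)
open import Data.Unit using (⊤)
open import Relation.Nullary using (¬_)
open import Relation.Binary.PropositionalEquality using (_≡_; _≢_)
open import Relation.Binary.Structures using (IsTotalOrder)

-- A totally ordered abelian group (the role played by (ℝ, +, ≤) in the
-- paper; agda-stdlib has no real numbers).

record OrderedAbelianGroup : Set₁ where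
  infixl 6 _+_
  infix  4 _≤_
  field
    Carrier     : Set
    _+_         : Carrier → Carrier → Carrier
    0#          : Carrier
    -_          : Carrier → Carrier
    _≤_         : Carrier → Carrier → Set
    +-assoc     : ∀ x y z → (x + y) + z ≡ x + (y + z)
    +-comm      : ∀ x y → x + y ≡ y + x
    +-identityˡ : ∀ x → 0# + x ≡ x
    +-inverseˡ  : ∀ x → (- x) + x ≡ 0#
    isTotalOrder : IsTotalOrder _≡_ _≤_
    +-monoˡ-≤   : ∀ {x y} z → x ≤ y → x + z ≤ y + z

module Tropical (G : OrderedAbelianGroup) where
  open OrderedAbelianGroup G renaming (_+_ to _+G_; _≤_ to _≤G_)

  data 𝕋 : Set where
    fin : Carrier → 𝕋
    ∞   : 𝕋

  infixl 6 _⊙_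
  _⊙_ : 𝕋 → 𝕋 → 𝕋
  fin a ⊙ fin b = fin (a +G b)
  fin a ⊙ ∞     = ∞
  ∞     ⊙ _     = ∞

  infix 4 _≼_
  data _≼_ : 𝕋 → 𝕋 → Set where
    fin≼fin : ∀ {a b} → a ≤G b → fin a ≼ fin b
    ≼∞      : ∀ {x} → x ≼ ∞

  -- A vector in 𝕋^(binom [n] r): a function on subsets of [n]; only
  -- its values on r-element subsets are ever used.
  Vector : ℕ → Set
  Vector n = Subset n → 𝕋

  exch : ∀ {n} → Subset n → Fin n → Fin n → Subset n
  exch I i j = (I - i) ∪ ⁅ j ⁆

  NotAllInfty : ∀ {n} → ℕ → Vector n → Set
  NotAllInfty r p = ∃ λ I → ∣ I ∣ ≡ r × p I ≢ ∞

  -- "The minimum of the family (f a)_{a with P a} is attained at least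
  -- twice" (at two distinct indices); true by convention if all entries
  -- are ∞.
  MinAttainedTwice : {A : Set} → (A → Set) → (A → 𝕋) → Set
  MinAttainedTwice {A} P f =
    (∀ a → P a → f a ≡ ∞) ⊎
    Σ A λ a → Σ A λ b → P a × P b × a ≢ b × f a ≡ f b ×
      (∀ c → P c → f a ≼ f c)

  IsMatroidBases : (n r : ℕ) → (Subset n → Set) → Set
  IsMatroidBases n r ℬ =
    (∀ B → ℬ B → ∣ B ∣ ≡ r) ×
    (∃ λ B → ℬ B) ×
    (∀ B B' i → ℬ B → ℬ B' → i ∈ B → i ∉ B' →
       ∃ λ j → j ∈ B' × j ∉ B × ℬ (exch B i j))

  Bases : ∀ {n} → ℕ → Vector n → Subset n → Set
  Bases r μ I = ∣ I ∣ ≡ r × μ I ≢ ∞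

  IsValuatedMatroid : (n r : ℕ) → Vector n → Set
  IsValuatedMatroid n r μ =
    IsMatroidBases n r (Bases r μ) ×
    (∀ B B' i → Bases r μ B → Bases r μ B' → i ∈ B → i ∉ B' →
       ∃ λ j → j ∈ B' × j ∉ B ×
         (μ (exch B i j) ⊙ μ (exch B' j i) ≼ μ B ⊙ μ B'))

  Quotient : ∀ {n} → (r s : ℕ) → Vector n → Vector n → Set
  Quotient r s μ ν =
    ∀ I J i → Bases r μ I → Bases s ν J → i ∈ I → i ∉ J →
      ∃ λ j → j ∈ J × j ∉ I ×
        (μ (exch I i j) ⊙ ν (exch J j i) ≼ μ I ⊙ ν J)

  GPIndex : ∀ {n} → Subset n → Subset n → Maybe (Fin n) → Set
  GPIndex I J nothing  = ⊤
  GPIndex I J (just j) = j ∈ J × j ∉ I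

  GPTerm : ∀ {n} → Vector n → Subset n → Subset n → Fin n →
           Maybe (Fin n) → 𝕋
  GPTerm p I J i nothing  = p I ⊙ p J
  GPTerm p I J i (just j) = p (exch I i j) ⊙ p (exch J j i)

  GrassmannPlucker : ∀ {n} → ℕ → Vector n → Set
  GrassmannPlucker r p =
    ∀ I J i → ∣ I ∣ ≡ r → ∣ J ∣ ≡ r → suc ∣ I ∩ J ∣ < r →
      i ∈ I → i ∉ J →
      MinAttainedTwice (GPIndex I J) (GPTerm p I J i)

  IncidencePlucker : ∀ {n} → (r s : ℕ) → Vector n → Vector n → Set
  IncidencePlucker r s p q =
    ∀ I' J' → suc ∣ I' ∣ ≡ r → ∣ J' ∣ ≡ suc s →
      MinAttainedTwice (λ j → j ∈ J' × j ∉ I')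
                       (λ j → p (I' ∪ ⁅ j ⁆) ⊙ q (J' - j))

  RankSeq : ∀ {k} → ℕ → Vec ℕ k → Set
  RankSeq n rs =
    (∀ a b → a ≤ᶠ b → lookup rs a ≤ℕ lookup rs b) × (∀ a → lookup rs a ≤ℕ n)

  -- (p̄₁,…,p̄_k) ∈ FlDr(r₁,…,r_k;n), stated on representatives (all
  -- relations are invariant under adding constants); each pᵢ must be a
  -- point of ℙ(𝕋^…), i.e. not the all-∞ vector.
  InFlagDressian : ∀ {k} → (n : ℕ) → Vec ℕ k → Vec (Vector n) k → Set
  InFlagDressian n rs ps =
    (∀ a → NotAllInfty (lookup rs a) (lookup ps a)) ×
    (∀ a → GrassmannPlucker (lookup rs a) (lookup ps a)) ×
    (∀ a b → a <ᶠ b →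
       IncidencePlucker (lookup rs a) (lookup rs b) (lookup ps a) (lookup ps b))

  IsValuatedFlagMatroid : ∀ {k} → (n : ℕ) → Vec ℕ k → Vec (Vector n) k → Set
  IsValuatedFlagMatroid n rs ps =
    (∀ a → IsValuatedMatroid n (lookup rs a) (lookup ps a)) ×
    (∀ a b → a <ᶠ b →
       Quotient (lookup rs a) (lookup rs b) (lookup ps a) (lookup ps b))

{-# OPTIONS --safe #-}
-- The minimum of a finite family of tropical numbers is attained twice iff every
-- finite term has a rival: a different term that is no larger.  Read this way, the
-- Grassmann–Plücker relation for (I, J, i) at its term p(I) + p(J) is the valuated
-- exchange axiom for (I, J, i), and at its term indexed by j it is the exchange axiom
-- for (I − i + j, J − j + i, j), whose rival j′ = i recovers p(I) + p(J).  The pairs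
-- with |I ∩ J| ≥ r − 1 carry no relation, but for them J = I − i + j and the exchange
-- inequality is an equality.  In the same way the incidence–Plücker relation for
-- (I′, J′) at j is the quotient axiom for (I′ + j, J′ − j, j), and conversely the quotient
-- axiom for (I, J, i) is the relation for (I − i, J + i) at i.  No rank condition
-- (r ≤ s ≤ n, or the ordering of a rank sequence) is needed.
module Submission where

open import Defs
open import Data.Nat using (ℕ; zero; suc; _≤_; _<_; s≤s; z≤n; s≤s⁻¹)
open import Data.Nat.Properties using (≤-trans; ≤-reflexive; n≮n; <⇒≤; ≮⇒≥; suc-injective; _<?_)
open import Data.Fin using (Fin; zero; suc; _≟_) renaming (_<_ to _<ᶠ_)
open import Data.Fin.Subset using (Subset; _∈_; _∉_; _⊆_; _∩_; _∪_; _─_; _-_; ⁅_⁆; ∣_∣; inside; outside)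
open import Data.Fin.Subset.Properties
open import Data.List using (List; []; _∷_; allFin; map)
open import Data.List.Relation.Unary.Any using (here; there)
open import Data.List.Membership.Propositional using () renaming (_∈_ to _∈ₗ_)
open import Data.List.Membership.Propositional.Properties using (∈-allFin; ∈-map⁺)
open import Data.Maybe using (Maybe; just; nothing)
open import Data.Maybe.Properties using (just-injective) renaming (≡-dec to ≡-dec-Maybe)
open import Data.Product using (∃; _×_; _,_; proj₁; proj₂)
open import Data.Sum using (_⊎_; inj₁; inj₂)
import Data.Sum as Sum
open import Data.Unit using (tt)
open import Data.Vec using (Vec; _∷_; []; lookup; here; there)
open import Function using (_∘_)
open import Function.Bundles using (_⇔_; mk⇔)
import Function.Properties.Equivalence as ⇔
open import Relation.Nullary using (¬_; Dec; yes; no; ¬?; _×-dec_; contradiction)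
open import Relation.Unary using (Decidable)
open import Relation.Binary.Definitions using (DecidableEquality)
open import Relation.Binary.PropositionalEquality
  using (_≡_; _≢_; refl; sym; trans; cong; cong₂; subst; subst₂; module ≡-Reasoning)
open import Relation.Binary.Structures using (IsTotalOrder)

private variable
  n : ℕ
  x y : Fin n
  p q : Subset n

x∈p─q⁻ : x ∈ p ─ q → x ∈ p × x ∉ q
x∈p─q⁻ {p = inside ∷ _} {q = outside ∷ _} here = here , λ ()
x∈p─q⁻ {x = zero} {p = _ ∷ _} {q = inside ∷ _} ()
x∈p─q⁻ {x = zero} {p = outside ∷ _} {q = outside ∷ _} ()
x∈p─q⁻ {p = _ ∷ _} {q = _ ∷ _} (there x∈) with x∈p─q⁻ x∈
... | x∈p , x∉q = there x∈p , λ { (there x∈q) → x∉q x∈q }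

x∈p-y⁻ : x ∈ p - y → x ∈ p × x ≢ y
x∈p-y⁻ x∈ with x∈p─q⁻ x∈
... | x∈p , x∉⁅y⁆ = x∈p , x∉⁅y⁆⇒x≢y x∉⁅y⁆

x∉p-x : x ∉ p - x
x∉p-x x∈ = proj₂ (x∈p-y⁻ x∈) refl

x∈p∪⁅y⁆⁻ : x ∈ p ∪ ⁅ y ⁆ → x ∈ p ⊎ x ≡ y
x∈p∪⁅y⁆⁻ {p = p} {y = y} x∈ = Sum.map₂ (x∈⁅y⁆⇒x≡y y) (x∈p∪q⁻ p ⁅ y ⁆ x∈)

x∈p∪⁅x⁆ : x ∈ p ∪ ⁅ x ⁆
x∈p∪⁅x⁆ {x = x} = x∈p∪q⁺ (inj₂ (x∈⁅x⁆ x))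

x∈p⇒x∈p∪q : x ∈ p → x ∈ p ∪ q
x∈p⇒x∈p∪q x∈p = x∈p∪q⁺ (inj₁ x∈p)

p-x∪⁅x⁆≡p : x ∈ p → (p - x) ∪ ⁅ x ⁆ ≡ p
p-x∪⁅x⁆≡p {x = x} {p = p} x∈p = ⊆-antisym ⊆p p⊆
  where
  ⊆p : (p - x) ∪ ⁅ x ⁆ ⊆ p
  ⊆p y∈ with x∈p∪⁅y⁆⁻ y∈
  ... | inj₁ y∈p-x = proj₁ (x∈p-y⁻ y∈p-x)
  ... | inj₂ refl  = x∈p
  p⊆ : p ⊆ (p - x) ∪ ⁅ x ⁆
  p⊆ {y} y∈p with y ≟ x
  ... | yes refl = x∈p∪⁅x⁆
  ... | no y≢x   = x∈p⇒x∈p∪q (x∈p∧x≢y⇒x∈p-y y∈p y≢x)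

p∪⁅x⁆-x≡p : x ∉ p → (p ∪ ⁅ x ⁆) - x ≡ p
p∪⁅x⁆-x≡p {x = x} {p = p} x∉p = ⊆-antisym ⊆p p⊆
  where
  ⊆p : (p ∪ ⁅ x ⁆) - x ⊆ p
  ⊆p y∈ with x∈p-y⁻ y∈
  ... | y∈ , y≢x with x∈p∪⁅y⁆⁻ y∈
  ...   | inj₁ y∈p = y∈p
  ...   | inj₂ y≡x = contradiction y≡x y≢x
  p⊆ : p ⊆ (p ∪ ⁅ x ⁆) - x
  p⊆ y∈p = x∈p∧x≢y⇒x∈p-y (x∈p⇒x∈p∪q y∈p) λ { refl → x∉p y∈p }

p∪⁅x⁆-y≡p-y∪⁅x⁆ : y ≢ x → (p ∪ ⁅ x ⁆) - y ≡ (p - y) ∪ ⁅ x ⁆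
p∪⁅x⁆-y≡p-y∪⁅x⁆ {y = y} {x = x} {p = p} y≢x = ⊆-antisym ⊆r r⊆
  where
  ⊆r : (p ∪ ⁅ x ⁆) - y ⊆ (p - y) ∪ ⁅ x ⁆
  ⊆r z∈ with x∈p-y⁻ z∈
  ... | z∈ , z≢y with x∈p∪⁅y⁆⁻ z∈
  ...   | inj₁ z∈p = x∈p⇒x∈p∪q (x∈p∧x≢y⇒x∈p-y z∈p z≢y)
  ...   | inj₂ refl = x∈p∪⁅x⁆
  r⊆ : (p - y) ∪ ⁅ x ⁆ ⊆ (p ∪ ⁅ x ⁆) - y
  r⊆ z∈ with x∈p∪⁅y⁆⁻ z∈
  ... | inj₁ z∈p-y = let z∈p , z≢y = x∈p-y⁻ z∈p-y in x∈p∧x≢y⇒x∈p-y (x∈p⇒x∈p∪q z∈p) z≢y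
  ... | inj₂ refl  = x∈p∧x≢y⇒x∈p-y x∈p∪⁅x⁆ (y≢x ∘ sym)

p-x-y∪⁅x⁆≡p-y : x ∈ p → y ≢ x → (p - x - y) ∪ ⁅ x ⁆ ≡ p - y
p-x-y∪⁅x⁆≡p-y {x = x} {p = p} {y = y} x∈p y≢x = begin
  (p - x - y) ∪ ⁅ x ⁆ ≡⟨ cong (_∪ ⁅ x ⁆) (p─x─y≡p─y─x p x y) ⟩
  (p - y - x) ∪ ⁅ x ⁆ ≡⟨ p-x∪⁅x⁆≡p (x∈p∧x≢y⇒x∈p-y x∈p (y≢x ∘ sym)) ⟩
  p - y               ∎
  where open ≡-Reasoning

x∉p⇒∣p∪⁅x⁆∣≡1+∣p∣ : x ∉ p → ∣ p ∪ ⁅ x ⁆ ∣ ≡ suc ∣ p ∣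
x∉p⇒∣p∪⁅x⁆∣≡1+∣p∣ {x = zero}  {p = inside ∷ p}  x∉p = contradiction here x∉p
x∉p⇒∣p∪⁅x⁆∣≡1+∣p∣ {x = zero}  {p = outside ∷ p} _   = cong (suc ∘ ∣_∣) (∪-identityʳ p)
x∉p⇒∣p∪⁅x⁆∣≡1+∣p∣ {x = suc x} {p = inside ∷ p}  x∉p = cong suc (x∉p⇒∣p∪⁅x⁆∣≡1+∣p∣ (x∉p ∘ there))
x∉p⇒∣p∪⁅x⁆∣≡1+∣p∣ {x = suc x} {p = outside ∷ p} x∉p = x∉p⇒∣p∪⁅x⁆∣≡1+∣p∣ (x∉p ∘ there)

x∈p⇒1+∣p-x∣≡∣p∣ : x ∈ p → suc ∣ p - x ∣ ≡ ∣ p ∣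
x∈p⇒1+∣p-x∣≡∣p∣ {x = x} {p = p} x∈p = begin
  suc ∣ p - x ∣         ≡⟨ x∉p⇒∣p∪⁅x⁆∣≡1+∣p∣ (x∉p-x {p = p}) ⟨
  ∣ (p - x) ∪ ⁅ x ⁆ ∣ ≡⟨ cong ∣_∣ (p-x∪⁅x⁆≡p x∈p) ⟩
  ∣ p ∣                 ∎
  where open ≡-Reasoning

p⊆q∧∣q∣≤∣p∣⇒p≡q : p ⊆ q → ∣ q ∣ ≤ ∣ p ∣ → p ≡ q
p⊆q∧∣q∣≤∣p∣⇒p≡q {p = []}          {q = []}          _   _ = refl
p⊆q∧∣q∣≤∣p∣⇒p≡q {p = inside ∷ p}  {q = inside ∷ q}  p⊆q ∣q∣≤∣p∣ =
  cong (inside ∷_) (p⊆q∧∣q∣≤∣p∣⇒p≡q (drop-∷-⊆ p⊆q) (s≤s⁻¹ ∣q∣≤∣p∣))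
p⊆q∧∣q∣≤∣p∣⇒p≡q {p = outside ∷ p} {q = outside ∷ q} p⊆q ∣q∣≤∣p∣ =
  cong (outside ∷_) (p⊆q∧∣q∣≤∣p∣⇒p≡q (drop-∷-⊆ p⊆q) ∣q∣≤∣p∣)
p⊆q∧∣q∣≤∣p∣⇒p≡q {p = inside ∷ p}  {q = outside ∷ q}  p⊆q _ with p⊆q here
... | ()
p⊆q∧∣q∣≤∣p∣⇒p≡q {p = outside ∷ p} {q = inside ∷ q}  p⊆q ∣q∣≤∣p∣ =
  contradiction (≤-trans ∣q∣≤∣p∣ (p⊆q⇒∣p∣≤∣q∣ (drop-∷-⊆ p⊆q))) (n≮n ∣ q ∣)

∈∖-there : ∀ {s t} → (∃ λ x → x ∈ q × x ∉ p) → ∃ λ x → x ∈ t ∷ q × x ∉ s ∷ p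
∈∖-there (x , x∈q , x∉p) = suc x , there x∈q , x∉p ∘ drop-there

∣p∣<∣q∣⇒∃x∈q∖p : ∣ p ∣ < ∣ q ∣ → ∃ λ x → x ∈ q × x ∉ p
∣p∣<∣q∣⇒∃x∈q∖p {p = outside ∷ p} {q = inside ∷ q}  _       = zero , here , λ ()
∣p∣<∣q∣⇒∃x∈q∖p {p = inside ∷ p}  {q = inside ∷ q}  ∣p∣<∣q∣ = ∈∖-there (∣p∣<∣q∣⇒∃x∈q∖p (s≤s⁻¹ ∣p∣<∣q∣))
∣p∣<∣q∣⇒∃x∈q∖p {p = outside ∷ p} {q = outside ∷ q} ∣p∣<∣q∣ = ∈∖-there (∣p∣<∣q∣⇒∃x∈q∖p ∣p∣<∣q∣)
∣p∣<∣q∣⇒∃x∈q∖p {p = inside ∷ p}  {q = outside ∷ q} ∣p∣<∣q∣ = ∈∖-there (∣p∣<∣q∣⇒∃x∈q∖p (<⇒≤ ∣p∣<∣q∣))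

∣p-x∣≤∣p∩q∣⇒p-x⊆q : x ∉ q → ∣ p - x ∣ ≤ ∣ p ∩ q ∣ → p - x ⊆ q
∣p-x∣≤∣p∩q∣⇒p-x⊆q {x = x} {q = q} {p = p} x∉q ∣p-x∣≤∣p∩q∣ =
  subst (_⊆ q) (p⊆q∧∣q∣≤∣p∣⇒p≡q p∩q⊆p-x ∣p-x∣≤∣p∩q∣) (p∩q⊆q p q)
  where
  p∩q⊆p-x : p ∩ q ⊆ p - x
  p∩q⊆p-x y∈ = let y∈p , y∈q = x∈p∩q⁻ p q y∈ in x∈p∧x≢y⇒x∈p-y y∈p λ { refl → x∉q y∈q }

p-x⊆q⇒∃y[p-x∪⁅y⁆≡q] : x ∈ p → x ∉ q → p - x ⊆ q → ∣ q ∣ ≡ ∣ p ∣ →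
  ∃ λ y → y ∈ q × y ∉ p × (p - x) ∪ ⁅ y ⁆ ≡ q
p-x⊆q⇒∃y[p-x∪⁅y⁆≡q] {x = x} {p = p} {q = q} x∈p x∉q p-x⊆q ∣q∣≡∣p∣
  with ∣p∣<∣q∣⇒∃x∈q∖p {p = p - x} {q = q} (≤-reflexive (trans (x∈p⇒1+∣p-x∣≡∣p∣ x∈p) (sym ∣q∣≡∣p∣)))
... | y , y∈q , y∉p-x = y , y∈q , y∉p , p⊆q∧∣q∣≤∣p∣⇒p≡q p-x∪⁅y⁆⊆q (≤-reflexive ∣q∣≡∣p-x∪⁅y⁆∣)
  where
  y∉p : y ∉ p
  y∉p y∈p = y∉p-x (x∈p∧x≢y⇒x∈p-y y∈p λ { refl → x∉q y∈q })
  p-x∪⁅y⁆⊆q : (p - x) ∪ ⁅ y ⁆ ⊆ q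
  p-x∪⁅y⁆⊆q z∈ with x∈p∪⁅y⁆⁻ z∈
  ... | inj₁ z∈p-x = p-x⊆q z∈p-x
  ... | inj₂ refl  = y∈q
  ∣q∣≡∣p-x∪⁅y⁆∣ : ∣ q ∣ ≡ ∣ (p - x) ∪ ⁅ y ⁆ ∣
  ∣q∣≡∣p-x∪⁅y⁆∣ = begin
    ∣ q ∣                 ≡⟨ ∣q∣≡∣p∣ ⟩
    ∣ p ∣                 ≡⟨ x∈p⇒1+∣p-x∣≡∣p∣ x∈p ⟨
    suc ∣ p - x ∣         ≡⟨ x∉p⇒∣p∪⁅x⁆∣≡1+∣p∣ y∉p-x ⟨
    ∣ (p - x) ∪ ⁅ y ⁆ ∣ ∎
    where open ≡-Reasoning

module _ (G : OrderedAbelianGroup) where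
  open OrderedAbelianGroup G using (+-comm; isTotalOrder)
  open Tropical G
  private module ≤ = IsTotalOrder isTotalOrder

  private variable
    A : Set
    r s : ℕ
    μ ν : Vector n
    I J : Subset n
    i j k : Fin n
    u v w : 𝕋

  ≼-refl : u ≼ u
  ≼-refl {fin a} = fin≼fin ≤.refl
  ≼-refl {∞}     = ≼∞

  ≼-reflexive : u ≡ v → u ≼ v
  ≼-reflexive refl = ≼-refl

  ≼-trans : u ≼ v → v ≼ w → u ≼ w
  ≼-trans (fin≼fin a≤b) (fin≼fin b≤c) = fin≼fin (≤.trans a≤b b≤c)
  ≼-trans _             ≼∞            = ≼∞

  ≼-antisym : u ≼ v → v ≼ u → u ≡ v
  ≼-antisym (fin≼fin a≤b) (fin≼fin b≤a) = cong fin (≤.antisym a≤b b≤a)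
  ≼-antisym ≼∞            ≼∞            = refl

  ≼-total : ∀ u v → u ≼ v ⊎ v ≼ u
  ≼-total (fin a) (fin b) = Sum.map fin≼fin fin≼fin (≤.total a b)
  ≼-total u       ∞       = inj₁ ≼∞
  ≼-total ∞       (fin b) = inj₂ ≼∞

  _≟∞ : ∀ u → Dec (u ≡ ∞)
  fin a ≟∞ = no λ ()
  ∞     ≟∞ = yes refl

  ∞≼⇒≡∞ : ∞ ≼ u → u ≡ ∞
  ∞≼⇒≡∞ ≼∞ = refl

  ⊙-comm : ∀ u v → u ⊙ v ≡ v ⊙ u
  ⊙-comm (fin a) (fin b) = cong fin (+-comm a b)
  ⊙-comm (fin a) ∞       = refl
  ⊙-comm ∞       (fin b) = refl
  ⊙-comm ∞       ∞       = refl

  ⊙≢∞⁻ : u ⊙ v ≢ ∞ → u ≢ ∞ × v ≢ ∞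
  ⊙≢∞⁻ {fin a} {fin b} _ = (λ ()) , (λ ())
  ⊙≢∞⁻ {fin a} {∞}     uv≢∞ = contradiction refl uv≢∞
  ⊙≢∞⁻ {∞}             uv≢∞ = contradiction refl uv≢∞

  ⊙≢∞⁺ : u ≢ ∞ → v ≢ ∞ → u ⊙ v ≢ ∞
  ⊙≢∞⁺ {fin a} {fin b} _    _    ()
  ⊙≢∞⁺ {fin a} {∞}     _    v≢∞ = contradiction refl v≢∞
  ⊙≢∞⁺ {∞}             u≢∞ _    = contradiction refl u≢∞

  ≼-≢∞ : u ≼ v → v ≢ ∞ → u ≢ ∞
  ≼-≢∞ (fin≼fin _) _   ()
  ≼-≢∞ ≼∞          ∞≢∞ = contradiction refl ∞≢∞

  Rivalled : (A → Set) → (A → 𝕋) → A → Set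
  Rivalled {A = A} P f a = ∃ λ (b : A) → P b × b ≢ a × f b ≼ f a

  AllRivalled : (A → Set) → (A → 𝕋) → Set
  AllRivalled P f = ∀ a → P a → f a ≢ ∞ → Rivalled P f a

  minAttainedTwice⇒allRivalled : {P : A → Set} {f : A → 𝕋} →
    DecidableEquality A → MinAttainedTwice P f → AllRivalled P f
  minAttainedTwice⇒allRivalled _≟ₐ_ (inj₁ all∞) a Pa fa≢∞ = contradiction (all∞ a Pa) fa≢∞
  minAttainedTwice⇒allRivalled _≟ₐ_ (inj₂ (m , m′ , Pm , Pm′ , m≢m′ , fm≡fm′ , m-min)) a Pa _
    with a ≟ₐ m
  ... | yes refl = m′ , Pm′ , m≢m′ ∘ sym , ≼-reflexive (sym fm≡fm′)
  ... | no a≢m   = m , Pm , a≢m ∘ sym , m-min a Pa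

  minimum : {P : A → Set} → Decidable P → (f : A → 𝕋) → (xs : List A) →
    (∀ a → a ∈ₗ xs → ¬ P a) ⊎ ∃ λ m → P m × ∀ a → a ∈ₗ xs → P a → f m ≼ f a
  minimum P? f [] = inj₁ λ _ ()
  minimum P? f (x ∷ xs) with P? x | minimum P? f xs
  ... | no ¬Px | inj₁ none = inj₁ λ { a (here refl) → ¬Px ; a (there a∈) → none a a∈ }
  ... | no ¬Px | inj₂ (m , Pm , m-min) =
    inj₂ (m , Pm , λ { a (here refl) Pa → contradiction Pa ¬Px ; a (there a∈) → m-min a a∈ })
  ... | yes Px | inj₁ none =
    inj₂ (x , Px , λ { a (here refl) _ → ≼-refl ; a (there a∈) Pa → contradiction Pa (none a a∈) })
  ... | yes Px | inj₂ (m , Pm , m-min) with ≼-total (f m) (f x)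
  ...   | inj₁ fm≼fx = inj₂ (m , Pm , λ { a (here refl) _ → fm≼fx ; a (there a∈) → m-min a a∈ })
  ...   | inj₂ fx≼fm =
    inj₂ (x , Px , λ { a (here refl) _ → ≼-refl ; a (there a∈) Pa → ≼-trans fx≼fm (m-min a a∈ Pa) })

  rivalledMinimum⇒minAttainedTwice : {P : A → Set} {f : A → 𝕋} {m : A} →
    AllRivalled P f → P m → (∀ a → P a → f m ≼ f a) → MinAttainedTwice P f
  rivalledMinimum⇒minAttainedTwice {f = f} {m} rivalled Pm m-min with f m ≟∞
  ... | yes fm≡∞ = inj₁ λ a Pa → ∞≼⇒≡∞ (subst (_≼ f a) fm≡∞ (m-min a Pa))
  ... | no fm≢∞ with rivalled m Pm fm≢∞
  ...   | m′ , Pm′ , m′≢m , fm′≼fm =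
    inj₂ (m , m′ , Pm , Pm′ , m′≢m ∘ sym , ≼-antisym (m-min m′ Pm′) fm′≼fm , m-min)

  allRivalled⇒minAttainedTwice : {P : A → Set} {f : A → 𝕋} (xs : List A) → (∀ a → a ∈ₗ xs) →
    Decidable P → AllRivalled P f → MinAttainedTwice P f
  allRivalled⇒minAttainedTwice {f = f} xs xs-complete P? rivalled with minimum P? f xs
  ... | inj₁ none = inj₁ λ a Pa → contradiction Pa (none a (xs-complete a))
  ... | inj₂ (m , Pm , m-min) =
    rivalledMinimum⇒minAttainedTwice rivalled Pm λ a → m-min a (xs-complete a)

  ∈exch⁻ : k ∈ exch I i j → k ≢ j → k ∈ I × k ≢ i
  ∈exch⁻ k∈ k≢j with x∈p∪⁅y⁆⁻ k∈
  ... | inj₁ k∈I-i = x∈p-y⁻ k∈I-i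
  ... | inj₂ k≡j   = contradiction k≡j k≢j

  ∉exch⁻ : k ∉ exch I i j → k ≢ i → k ∉ I
  ∉exch⁻ k∉ k≢i k∈I = k∉ (x∈p⇒x∈p∪q (x∈p∧x≢y⇒x∈p-y k∈I k≢i))

  ∣exch∣ : i ∈ I → j ∉ I → ∣ exch I i j ∣ ≡ ∣ I ∣
  ∣exch∣ i∈I j∉I = trans (x∉p⇒∣p∪⁅x⁆∣≡1+∣p∣ (j∉I ∘ proj₁ ∘ x∈p-y⁻)) (x∈p⇒1+∣p-x∣≡∣p∣ i∈I)

  exch-exch : j ∉ I → exch (exch I i j) j k ≡ exch I i k
  exch-exch {k = k} j∉I = cong (_∪ ⁅ k ⁆) (p∪⁅x⁆-x≡p (j∉I ∘ proj₁ ∘ x∈p-y⁻))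

  exch-exch-inverse : i ∈ I → j ∉ I → exch (exch I i j) j i ≡ I
  exch-exch-inverse i∈I j∉I = trans (exch-exch j∉I) (p-x∪⁅x⁆≡p i∈I)

  exch-exch-swap : j ∈ J → k ≢ i → k ≢ j → exch (exch J j i) k j ≡ exch J k i
  exch-exch-swap {j = j} {J = J} {k = k} {i = i} j∈J k≢i k≢j = begin
    (((J - j) ∪ ⁅ i ⁆) - k) ∪ ⁅ j ⁆ ≡⟨ cong (_∪ ⁅ j ⁆) (p∪⁅x⁆-y≡p-y∪⁅x⁆ k≢i) ⟩
    ((J - j - k) ∪ ⁅ i ⁆) ∪ ⁅ j ⁆   ≡⟨ ∪-assoc (J - j - k) ⁅ i ⁆ ⁅ j ⁆ ⟩
    (J - j - k) ∪ (⁅ i ⁆ ∪ ⁅ j ⁆)   ≡⟨ cong ((J - j - k) ∪_) (∪-comm ⁅ i ⁆ ⁅ j ⁆) ⟩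
    (J - j - k) ∪ (⁅ j ⁆ ∪ ⁅ i ⁆)   ≡⟨ ∪-assoc (J - j - k) ⁅ j ⁆ ⁅ i ⁆ ⟨
    ((J - j - k) ∪ ⁅ j ⁆) ∪ ⁅ i ⁆   ≡⟨ cong (_∪ ⁅ i ⁆) (p-x-y∪⁅x⁆≡p-y j∈J k≢j) ⟩
    (J - k) ∪ ⁅ i ⁆                 ∎
    where open ≡-Reasoning

  exch-adjacent : ∀ {B B′ : Subset n} → ∣ B ∣ ≡ r → ∣ B′ ∣ ≡ r → r ≤ suc ∣ B ∩ B′ ∣ →
    i ∈ B → i ∉ B′ → ∃ λ j → j ∈ B′ × j ∉ B × exch B i j ≡ B′
  exch-adjacent {r = r} {i = i} {B = B} {B′} ∣B∣≡r ∣B′∣≡r r≤1+∣B∩B′∣ i∈B i∉B′ =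
    p-x⊆q⇒∃y[p-x∪⁅y⁆≡q] i∈B i∉B′ B-i⊆B′ (trans ∣B′∣≡r (sym ∣B∣≡r))
    where
    B-i⊆B′ : B - i ⊆ B′
    B-i⊆B′ = ∣p-x∣≤∣p∩q∣⇒p-x⊆q i∉B′
      (s≤s⁻¹ (≤-trans (≤-reflexive (trans (x∈p⇒1+∣p-x∣≡∣p∣ i∈B) ∣B∣≡r)) r≤1+∣B∩B′∣))

  -- The valuated exchange axiom for μ is, verbatim, the quotient relation μ ↞ μ.
  exchange⇒matroidBases : NotAllInfty r μ → Quotient r r μ μ → IsMatroidBases n r (Bases r μ)
  exchange⇒matroidBases {r = r} {μ = μ} nonempty exchange = (λ _ → proj₁) , nonempty , basisExchange
    where
    basisExchange : ∀ B B′ i → Bases r μ B → Bases r μ B′ → i ∈ B → i ∉ B′ →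
      ∃ λ j → j ∈ B′ × j ∉ B × Bases r μ (exch B i j)
    basisExchange B B′ i (∣B∣≡r , μB≢∞) (∣B′∣≡r , μB′≢∞) i∈B i∉B′ =
      let j , j∈B′ , j∉B , ≼μBμB′ = exchange B B′ i (∣B∣≡r , μB≢∞) (∣B′∣≡r , μB′≢∞) i∈B i∉B′
      in  j , j∈B′ , j∉B , trans (∣exch∣ i∈B j∉B) ∣B∣≡r ,
          proj₁ (⊙≢∞⁻ (≼-≢∞ ≼μBμB′ (⊙≢∞⁺ μB≢∞ μB′≢∞)))

  exch-adjacent-tight : i ∈ I → j ∉ I → exch I i j ≡ J →
    μ (exch I i j) ⊙ μ (exch J j i) ≡ μ I ⊙ μ J
  exch-adjacent-tight {i = i} {I = I} {j = j} {μ = μ} i∈I j∉I refl = begin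
    μ (exch I i j) ⊙ μ (exch (exch I i j) j i)
      ≡⟨ cong (λ X → μ (exch I i j) ⊙ μ X) (exch-exch-inverse i∈I j∉I) ⟩
    μ (exch I i j) ⊙ μ I
      ≡⟨ ⊙-comm (μ (exch I i j)) (μ I) ⟩
    μ I ⊙ μ (exch I i j)
      ∎
    where open ≡-Reasoning

  grassmannPlucker⇒exchange : GrassmannPlucker r μ → Quotient r r μ μ
  grassmannPlucker⇒exchange {r = r} gp B B′ i (∣B∣≡r , μB≢∞) (∣B′∣≡r , μB′≢∞) i∈B i∉B′
    with suc ∣ B ∩ B′ ∣ <? r
  ... | no near =
    let j , j∈B′ , j∉B , B-i+j≡B′ = exch-adjacent ∣B∣≡r ∣B′∣≡r (≮⇒≥ near) i∈B i∉B′
    in  j , j∈B′ , j∉B , ≼-reflexive (exch-adjacent-tight i∈B j∉B B-i+j≡B′)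
  ... | yes far
    with minAttainedTwice⇒allRivalled (≡-dec-Maybe _≟_) (gp B B′ i ∣B∣≡r ∣B′∣≡r far i∈B i∉B′)
           nothing _ (⊙≢∞⁺ μB≢∞ μB′≢∞)
  ...   | just j  , (j∈B′ , j∉B) , _ , ≼μBμB′ = j , j∈B′ , j∉B , ≼μBμB′
  ...   | nothing , _ , nothing≢nothing , _  = contradiction refl nothing≢nothing

  maybeFins : (n : ℕ) → List (Maybe (Fin n))
  maybeFins n = nothing ∷ map just (allFin n)

  ∈-maybeFins : (a : Maybe (Fin n)) → a ∈ₗ maybeFins n
  ∈-maybeFins nothing  = here refl
  ∈-maybeFins (just j) = there (∈-map⁺ just (∈-allFin j))

  gpIndex? : (I J : Subset n) → Decidable (GPIndex I J)
  gpIndex? I J nothing  = yes tt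
  gpIndex? I J (just j) = j ∈? J ×-dec ¬? (j ∈? I)

  exchange⇒grassmannPlucker : Quotient r r μ μ → GrassmannPlucker r μ
  exchange⇒grassmannPlucker {r = r} {μ = μ} exchange I J i ∣I∣≡r ∣J∣≡r _ i∈I i∉J =
    allRivalled⇒minAttainedTwice (maybeFins _) ∈-maybeFins (gpIndex? I J) rivalled
    where
    term : Maybe (Fin _) → 𝕋
    term = GPTerm μ I J i
    rivalled : AllRivalled (GPIndex I J) term
    rivalled nothing _ μIμJ≢∞ with ⊙≢∞⁻ μIμJ≢∞
    ... | μI≢∞ , μJ≢∞ with exchange I J i (∣I∣≡r , μI≢∞) (∣J∣≡r , μJ≢∞) i∈I i∉J
    ...   | j , j∈J , j∉I , ≼μIμJ = just j , (j∈J , j∉I) , (λ ()) , ≼μIμJ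
    rivalled (just j) (j∈J , j∉I) term≢∞ with ⊙≢∞⁻ term≢∞
    ... | μI′≢∞ , μJ′≢∞
      with exchange (exch I i j) (exch J j i) j
             (trans (∣exch∣ i∈I j∉I) ∣I∣≡r , μI′≢∞) (trans (∣exch∣ j∈J i∉J) ∣J∣≡r , μJ′≢∞)
             x∈p∪⁅x⁆ (λ j∈J′ → proj₂ (∈exch⁻ j∈J′ λ { refl → i∉J j∈J }) refl)
    ...   | k , k∈J′ , k∉I′ , ≼term with k ≟ i
    ...     | yes refl = nothing , tt , (λ ()) ,
      subst₂ (λ X Y → μ X ⊙ μ Y ≼ term (just j)) (exch-exch-inverse i∈I j∉I) (exch-exch-inverse j∈J i∉J) ≼term
    ...     | no k≢i with ∈exch⁻ k∈J′ k≢i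
    ...       | k∈J , k≢j = just k , (k∈J , ∉exch⁻ k∉I′ k≢i) , k≢j ∘ just-injective ,
      subst₂ (λ X Y → μ X ⊙ μ Y ≼ term (just j)) (exch-exch j∉I) (exch-exch-swap j∈J k≢i k≢j) ≼term

  quotient⇒incidencePlucker : Quotient r s μ ν → IncidencePlucker r s μ ν
  quotient⇒incidencePlucker {r = r} {s = s} {μ = μ} {ν = ν} quotient I′ J′ 1+∣I′∣≡r ∣J′∣≡1+s =
    allRivalled⇒minAttainedTwice (allFin _) ∈-allFin (λ j → j ∈? J′ ×-dec ¬? (j ∈? I′)) rivalled
    where
    term : Fin _ → 𝕋
    term j = μ (I′ ∪ ⁅ j ⁆) ⊙ ν (J′ - j)
    rivalled : AllRivalled (λ j → j ∈ J′ × j ∉ I′) term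
    rivalled j (j∈J′ , j∉I′) term≢∞ with ⊙≢∞⁻ term≢∞
    ... | μI≢∞ , νJ≢∞
      with quotient (I′ ∪ ⁅ j ⁆) (J′ - j) j
             (trans (x∉p⇒∣p∪⁅x⁆∣≡1+∣p∣ j∉I′) 1+∣I′∣≡r , μI≢∞)
             (suc-injective (trans (x∈p⇒1+∣p-x∣≡∣p∣ j∈J′) ∣J′∣≡1+s) , νJ≢∞)
             x∈p∪⁅x⁆ x∉p-x
    ...   | k , k∈J′-j , k∉I′+j , ≼term with x∈p-y⁻ k∈J′-j
    ...     | k∈J′ , k≢j = k , (k∈J′ , k∉I′+j ∘ x∈p⇒x∈p∪q) , k≢j ,
      subst₂ (λ X Y → μ X ⊙ ν Y ≼ term j)
             (cong (_∪ ⁅ k ⁆) (p∪⁅x⁆-x≡p j∉I′)) (p-x-y∪⁅x⁆≡p-y j∈J′ k≢j) ≼term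

  incidencePlucker⇒quotient : IncidencePlucker r s μ ν → Quotient r s μ ν
  incidencePlucker⇒quotient {r = r} {s = s} {μ = μ} {ν = ν} ip I J i (∣I∣≡r , μI≢∞) (∣J∣≡s , νJ≢∞) i∈I i∉J =
    fromRival (minAttainedTwice⇒allRivalled _≟_
      (ip (I - i) (J ∪ ⁅ i ⁆) (trans (x∈p⇒1+∣p-x∣≡∣p∣ i∈I) ∣I∣≡r)
                              (trans (x∉p⇒∣p∪⁅x⁆∣≡1+∣p∣ i∉J) (cong suc ∣J∣≡s)))
      i (x∈p∪⁅x⁆ , x∉p-x) (subst (_≢ ∞) (sym term-i) (⊙≢∞⁺ μI≢∞ νJ≢∞)))
    where
    term : Fin _ → 𝕋
    term j = μ ((I - i) ∪ ⁅ j ⁆) ⊙ ν ((J ∪ ⁅ i ⁆) - j)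
    term-i : term i ≡ μ I ⊙ ν J
    term-i = cong₂ (λ X Y → μ X ⊙ ν Y) (p-x∪⁅x⁆≡p i∈I) (p∪⁅x⁆-x≡p i∉J)
    fromRival : Rivalled (λ j → j ∈ J ∪ ⁅ i ⁆ × j ∉ I - i) term i →
      ∃ λ j → j ∈ J × j ∉ I × μ (exch I i j) ⊙ ν (exch J j i) ≼ μ I ⊙ ν J
    fromRival (j , (j∈J+i , j∉I-i) , j≢i , ≼term-i) =
      j , j∈J , j∉I , subst₂ (λ Y t → μ (exch I i j) ⊙ ν Y ≼ t) (p∪⁅x⁆-y≡p-y∪⁅x⁆ j≢i) term-i ≼term-i
      where
      j∈J : j ∈ J
      j∈J = Sum.fromInj₁ (λ j≡i → contradiction j≡i j≢i) (x∈p∪⁅y⁆⁻ j∈J+i)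
      j∉I : j ∉ I
      j∉I j∈I = j∉I-i (x∈p∧x≢y⇒x∈p-y j∈I j≢i)

  grassmannPlucker⇒valuatedMatroid : NotAllInfty r μ → GrassmannPlucker r μ → IsValuatedMatroid n r μ
  grassmannPlucker⇒valuatedMatroid nonempty gp =
    exchange⇒matroidBases nonempty (grassmannPlucker⇒exchange gp) , grassmannPlucker⇒exchange gp

  flagDressian⇔valuatedFlagMatroid : ∀ {k} (rs : Vec ℕ k) (ps : Vec (Vector n) k) →
    InFlagDressian n rs ps ⇔ IsValuatedFlagMatroid n rs ps
  flagDressian⇔valuatedFlagMatroid rs ps = mk⇔
    (λ (nonempty , gp , ip) →
      (λ a → grassmannPlucker⇒valuatedMatroid (nonempty a) (gp a)) ,
      (λ a b a<b → incidencePlucker⇒quotient (ip a b a<b)))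
    (λ (vm , q) →
      (λ a → proj₁ (proj₂ (proj₁ (vm a)))) ,
      (λ a → exchange⇒grassmannPlucker (proj₂ (vm a))) ,
      (λ a b a<b → quotient⇒incidencePlucker (q a b a<b)))

  valuatedFlagMatroid₂⇔ : IsValuatedFlagMatroid n (r ∷ s ∷ []) (μ ∷ ν ∷ []) ⇔
    (IsValuatedMatroid n r μ × IsValuatedMatroid n s ν × Quotient r s μ ν)
  valuatedFlagMatroid₂⇔ {r = r} {s = s} {μ = μ} {ν = ν} = mk⇔
    (λ (vm , q) → vm zero , vm (suc zero) , q zero (suc zero) (s≤s z≤n))
    (λ (vmμ , vmν , q) → (λ { zero → vmμ ; (suc zero) → vmν }) , flagQuotient q)
    where
    flagQuotient : Quotient r s μ ν → ∀ a b → a <ᶠ b →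
      Quotient (lookup (r ∷ s ∷ []) a) (lookup (r ∷ s ∷ []) b) (lookup (μ ∷ ν ∷ []) a) (lookup (μ ∷ ν ∷ []) b)
    flagQuotient q zero       (suc zero) _ = q
    flagQuotient q (suc zero) (suc zero) (s≤s ())

proposition4p10 : (G : OrderedAbelianGroup) →
    let open Tropical G in
    (∀ (n r s : ℕ) (μ ν : Vector n) → r ≤ s → s ≤ n →
       NotAllInfty r μ → NotAllInfty s ν →
       (InFlagDressian n (r ∷ s ∷ []) (μ ∷ ν ∷ [])
         ⇔ (IsValuatedMatroid n r μ × IsValuatedMatroid n s ν × Quotient r s μ ν)))
    ×
    (∀ (n k : ℕ) (rs : Vec ℕ k) (ps : Vec (Vector n) k) → RankSeq n rs →
       (InFlagDressian n rs ps ⇔ IsValuatedFlagMatroid n rs ps))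
proposition4p10 G =
  (λ n r s μ ν _ _ _ _ →
    ⇔.trans (flagDressian⇔valuatedFlagMatroid G (r ∷ s ∷ []) (μ ∷ ν ∷ [])) (valuatedFlagMatroid₂⇔ G)) ,
  (λ n k rs ps _ → flagDressian⇔valuatedFlagMatroid G rs ps)
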